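{- Let $\Gamma$ be a finite graph that is locally $n\times n$ grid, and suppose there is a constant $m\in\{2,\dots,n-1\}$ such that $c_2(x,y)\geq 2m$ for all pairs of vertices $x,y$ at distance $2$. Then for every vertex $x$, \[ k_2(x)\leq\frac{n^2(n-1)^2}{2m},\qquad k_3(x)\leq k_2(x)\cdot\frac{(n-m)^2}{(m+1)^2}\leq\frac{n^2(n-1)^2(n-m)^2}{2m(m+1)^2}, \] and for every $i$ with $4\leq i\leq\epsilon(x)$, \[ k_i(x)\leq k_{i-1}(x)\cdot\frac{(n-m-1)^2}{(m+1)^2}. \]
   Context: A graph is locally $n\times n$ grid if the induced subgraph on every vertex neighbourhood is isomorphic to $K_n\square K_n$ (vertices $(i,j)$, $1\le i,j\le n$, adjacent iff they agree in exactly one coordinate). $\Gamma_i(x)$ is the set of vertices at distance $i$ from $x$, $k_i(x)=|\Gamma_i(x)|$, $c_2(x,y)=|\Gamma(x)\cap\Gamma(y)|$, and the eccentricity $\epsilon(x)=\max\{i:\Gamma_i(x)\neq\varnothing\}$. -}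

module Defs where

open import Data.Nat using (ℕ; zero; suc; _+_; _∸_)
import Data.Nat
open import Data.Bool using (Bool; true; false; _∧_; _∨_; not; if_then_else_)
open import Data.Fin using (Fin; _≟_)
import Data.Fin as F
open import Data.Product using (Σ; ∃; _×_; _,_)
open import Data.Sum using (_⊎_)
open import Relation.Nullary using (¬_)
open import Relation.Nullary.Decidable using (⌊_⌋)
open import Relation.Binary.PropositionalEquality using (_≡_; _≢_)
open import Function.Bundles using (_⇔_)

record Graph (N : ℕ) : Set where
  field
    adj     : Fin N → Fin N → Bool
    symm    : ∀ x y → adj x y ≡ adj y x
    irrefl  : ∀ x → adj x x ≡ false

open Graph public

_~[_]_ : ∀ {N} → Fin N → Graph N → Fin N → Set
x ~[ G ] y = adj G x y ≡ true

countB : ∀ {N} → (Fin N → Bool) → ℕ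
countB {zero}  f = 0
countB {suc N} f = (if f F.zero then 1 else 0) + countB (λ i → f (F.suc i))

anyB : ∀ {N} → (Fin N → Bool) → Bool
anyB {zero}  f = false
anyB {suc N} f = f F.zero ∨ anyB (λ i → f (F.suc i))

-- within G l x y = true  iff  d(x,y) ≤ l  (there is a walk of length ≤ l)
within : ∀ {N} → Graph N → ℕ → Fin N → Fin N → Bool
within G zero    x y = ⌊ x ≟ y ⌋
within G (suc l) x y = within G l x y ∨ anyB (λ z → within G l x z ∧ adj G z y)

-- atDist G i x y = true  iff  d(x,y) = i, i.e. y ∈ Γ_i(x)
atDist : ∀ {N} → Graph N → ℕ → Fin N → Fin N → Bool
atDist G zero    x y = within G zero x y
atDist G (suc i) x y = within G (suc i) x y ∧ not (within G i x y)

k : ∀ {N} → Graph N → ℕ → Fin N → ℕ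
k G i x = countB (atDist G i x)

c₂ : ∀ {N} → Graph N → Fin N → Fin N → ℕ
c₂ G x y = countB (λ z → adj G x z ∧ adj G y z)

IsEccentricity : ∀ {N} → Graph N → Fin N → ℕ → Set
IsEccentricity G x e =
  (∃ λ y → atDist G e x y ≡ true) × (∀ j → e Data.Nat.< j → ∀ y → atDist G j x y ≡ false)

-- adjacency of K_n □ K_n on Fin n × Fin n: agree in exactly one coordinate
GridAdj : ∀ {n} → Fin n × Fin n → Fin n × Fin n → Set
GridAdj (i , j) (i' , j') = (i ≡ i' × j ≢ j') ⊎ (i ≢ i' × j ≡ j')

-- the induced subgraph on Γ(x) is isomorphic to K_n □ K_n:
-- a bijection f : Fin n × Fin n → Γ(x) preserving and reflecting adjacency
LocallyGridAt : ∀ {N} → ℕ → Graph N → Fin N → Set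
LocallyGridAt {N} n G x =
  Σ (Fin n × Fin n → Fin N) λ f →
      (∀ p q → f p ≡ f q → p ≡ q)
    × (∀ p → x ~[ G ] f p)
    × (∀ y → x ~[ G ] y → ∃ λ p → f p ≡ y)
    × (∀ p q → (f p ~[ G ] f q) ⇔ GridAdj p q)

LocallyGrid : ∀ {N} → ℕ → Graph N → Set
LocallyGrid n G = ∀ x → LocallyGridAt n G x

-- Each bound double counts the edges between consecutive layers Γ_i(x) and
-- Γ_{i+1}(x) (layerCount), so it suffices to bound, for a vertex v of a layer,
-- its neighbours in the next and in the previous layer.  Both are read off a
-- grid labelling of Γ(v).  Forward: a neighbour of a in Γ_{j+2}(x) shares no
-- line of the grid at a with a point of Γ_j(x), so if Γ_j(x) meets r rows and
-- r columns there are at most (n − r)² such neighbours (forwardBound).  Here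
-- r = 1 at distance 1, r = m at distance 2 because a row holds at most two
-- common neighbours of x and a (noThreeInRow), and r = m + 1 further out: by
-- induction on the distance, lineTransfer carries the rows met in the grid at
-- a predecessor t of b into the row of t in the grid at b, which makes
-- Γ_{j+1}(x) ∩ Γ(b) dense there (rowThroughPredecessor, denseGridSet).  The
-- same density gives the backward bound (m + 1)² (backwardDegree); at distance
-- 2 it is c₂ ≥ 2m.

module Submission where

open import Defs
open import Data.Nat using (ℕ; _+_; _*_; _∸_; _≤_)
open import Data.Bool using (true)
open import Data.Fin using (Fin)
open import Data.Product using (_×_)
open import Relation.Binary.PropositionalEquality using (_≡_)

open import Data.Nat using (zero; suc; z≤n; s≤s; _≤?_)
open import Data.Nat.Properties
open import Data.Bool using (Bool; false; _∧_; _∨_; not; if_then_else_)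
open import Data.Bool.Properties using (∧-comm)
import Data.Fin as F
import Data.Fin.Properties as FP
open import Data.Product using (∃; _,_; proj₁; proj₂)
open import Data.Sum using (_⊎_; inj₁; inj₂)
open import Data.Empty using (⊥; ⊥-elim)
open import Relation.Nullary using (¬_; yes; no)
open import Relation.Nullary.Decidable using (⌊_⌋)
open import Relation.Binary.PropositionalEquality
  using (_≢_; refl; sym; trans; cong; cong₂; subst; subst₂; module ≡-Reasoning)
open import Function.Bundles using (Equivalence)

[_] : Bool → ℕ
[ b ] = if b then 1 else 0

[]≤1 : ∀ b → [ b ] ≤ 1
[]≤1 true  = s≤s z≤n
[]≤1 false = z≤n

1≤[]⇒true : ∀ {b} → 1 ≤ [ b ] → b ≡ true
1≤[]⇒true {true} _ = refl

[∧] : ∀ a b → [ a ∧ b ] ≡ [ a ] * [ b ]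
[∧] true  b = sym (+-identityʳ [ b ])
[∧] false b = refl

∧-fst : ∀ {a b} → (a ∧ b) ≡ true → a ≡ true
∧-fst {true} _ = refl

∧-snd : ∀ {a b} → (a ∧ b) ≡ true → b ≡ true
∧-snd {true} p = p

∧-intro : ∀ {a b} → a ≡ true → b ≡ true → (a ∧ b) ≡ true
∧-intro refl refl = refl

∨-introˡ : ∀ {a} b → a ≡ true → (a ∨ b) ≡ true
∨-introˡ b refl = refl

∨-introʳ : ∀ a {b} → b ≡ true → (a ∨ b) ≡ true
∨-introʳ true  _ = refl
∨-introʳ false h = h

not-true : ∀ {b} → not b ≡ true → b ≡ false
not-true {false} _ = refl

not-intro : ∀ {b} → ¬ (b ≡ true) → not b ≡ true
not-intro {true}  h = ⊥-elim (h refl)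
not-intro {false} _ = refl

anyB-witness : ∀ {M} (f : Fin M → Bool) → anyB f ≡ true → ∃ λ i → f i ≡ true
anyB-witness {suc M} f h with f F.zero in e
... | true  = F.zero , e
... | false with anyB-witness (λ i → f (F.suc i)) h
...   | i , p = F.suc i , p

anyB-intro : ∀ {M} (f : Fin M → Bool) i → f i ≡ true → anyB f ≡ true
anyB-intro f F.zero    h rewrite h = refl
anyB-intro f (F.suc i) h = ∨-introʳ (f F.zero) (anyB-intro (λ i → f (F.suc i)) i h)

eqB : ∀ {N} → Fin N → Fin N → Bool
eqB a b = ⌊ a F.≟ b ⌋

eqB-intro : ∀ {N} {a b : Fin N} → a ≡ b → eqB a b ≡ true
eqB-intro {a = a} refl with a F.≟ a
... | yes _ = refl
... | no ne = ⊥-elim (ne refl)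

eqB⇒≡ : ∀ {N} {a b : Fin N} → eqB a b ≡ true → a ≡ b
eqB⇒≡ {a = a} {b} h with a F.≟ b
... | yes e = e

record FiniteSum (X : Set) : Set where
  field
    sum         : (X → ℕ) → ℕ
    mono        : ∀ {f g} → (∀ x → f x ≤ g x) → sum f ≤ sum g
    additive    : ∀ f g → sum (λ x → f x + g x) ≡ sum f + sum g
    homogeneous : ∀ c f → sum (λ x → c * f x) ≡ c * sum f
    term≤sum    : ∀ f x → f x ≤ sum f
    witness     : ∀ f → 1 ≤ sum f → ∃ λ x → 1 ≤ f x
    atMostOne   : ∀ f → (∀ x → f x ≤ 1) → (∀ x y → 1 ≤ f x → 1 ≤ f y → x ≡ y) → sum f ≤ 1

  sum-cong : ∀ {f g} → (∀ x → f x ≡ g x) → sum f ≡ sum g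
  sum-cong e = ≤-antisym (mono (λ x → ≤-reflexive (e x))) (mono (λ x → ≤-reflexive (sym (e x))))

  sum-zero : ∀ f → (∀ x → f x ≡ 0) → sum f ≡ 0
  sum-zero f e = trans (sum-cong e) (homogeneous 0 (λ _ → 0))

open FiniteSum public

sumFin : ∀ N → (Fin N → ℕ) → ℕ
sumFin zero    f = 0
sumFin (suc N) f = f F.zero + sumFin N (λ i → f (F.suc i))

countB≡sumFin : ∀ {N} (f : Fin N → Bool) → countB f ≡ sumFin N (λ i → [ f i ])
countB≡sumFin {zero}  f = refl
countB≡sumFin {suc N} f = cong ([ f F.zero ] +_) (countB≡sumFin (λ i → f (F.suc i)))

sumFin-const : ∀ N c → sumFin N (λ _ → c) ≡ N * c
sumFin-const zero    c = refl
sumFin-const (suc N) c = cong (c +_) (sumFin-const N c)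

private
  +-interchange : ∀ a b c d → (a + b) + (c + d) ≡ (a + c) + (b + d)
  +-interchange a b c d = begin
      (a + b) + (c + d) ≡⟨ +-assoc a b (c + d) ⟩
      a + (b + (c + d)) ≡⟨ cong (a +_) (sym (+-assoc b c d)) ⟩
      a + ((b + c) + d) ≡⟨ cong (λ z → a + (z + d)) (+-comm b c) ⟩
      a + ((c + b) + d) ≡⟨ cong (a +_) (+-assoc c b d) ⟩
      a + (c + (b + d)) ≡⟨ sym (+-assoc a c (b + d)) ⟩
      (a + c) + (b + d) ∎
    where open ≡-Reasoning

  sumFin-zero : ∀ N (f : Fin N → ℕ) → (∀ x → f x ≡ 0) → sumFin N f ≡ 0
  sumFin-zero zero    f e = refl
  sumFin-zero (suc N) f e rewrite e F.zero = sumFin-zero N _ (λ i → e (F.suc i))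

finSum : ∀ N → FiniteSum (Fin N)
finSum N = record
  { sum = sumFin N ; mono = mono′ N ; additive = additive′ N ; homogeneous = homogeneous′ N
  ; term≤sum = term≤sum′ N ; witness = witness′ N ; atMostOne = atMostOne′ N }
  where
    mono′ : ∀ N {f g : Fin N → ℕ} → (∀ x → f x ≤ g x) → sumFin N f ≤ sumFin N g
    mono′ zero    h = z≤n
    mono′ (suc N) h = +-mono-≤ (h F.zero) (mono′ N (λ i → h (F.suc i)))

    additive′ : ∀ N (f g : Fin N → ℕ) → sumFin N (λ x → f x + g x) ≡ sumFin N f + sumFin N g
    additive′ zero    f g = refl
    additive′ (suc N) f g = trans (cong (f F.zero + g F.zero +_) (additive′ N _ _))
                                  (+-interchange (f F.zero) (g F.zero) _ _)

    homogeneous′ : ∀ N c (f : Fin N → ℕ) → sumFin N (λ x → c * f x) ≡ c * sumFin N f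
    homogeneous′ zero    c f = sym (*-zeroʳ c)
    homogeneous′ (suc N) c f = trans (cong (c * f F.zero +_) (homogeneous′ N c _))
                                     (sym (*-distribˡ-+ c (f F.zero) _))

    term≤sum′ : ∀ N (f : Fin N → ℕ) x → f x ≤ sumFin N f
    term≤sum′ (suc N) f F.zero    = m≤m+n _ _
    term≤sum′ (suc N) f (F.suc x) = ≤-trans (term≤sum′ N (λ i → f (F.suc i)) x) (m≤n+m _ _)

    witness′ : ∀ N (f : Fin N → ℕ) → 1 ≤ sumFin N f → ∃ λ x → 1 ≤ f x
    witness′ (suc N) f h with f F.zero in eq
    ... | suc _ = F.zero , subst (1 ≤_) (sym eq) (s≤s z≤n)
    ... | zero with witness′ N (λ i → f (F.suc i)) h
    ...   | x , p = F.suc x , p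

    -- if f F.zero is positive, uniqueness forces the rest of the sum to vanish
    atMostOne′ : ∀ N (f : Fin N → ℕ) → (∀ x → f x ≤ 1) → (∀ x y → 1 ≤ f x → 1 ≤ f y → x ≡ y)
               → sumFin N f ≤ 1
    atMostOne′ zero    f b u = z≤n
    atMostOne′ (suc N) f b u with f F.zero in eq
    ... | zero  = atMostOne′ N _ (λ i → b (F.suc i)) (λ x y p q → FP.suc-injective (u _ _ p q))
    ... | suc k = subst (λ s → suc k + s ≤ 1) (sym (sumFin-zero N _ rest-zero))
                    (subst (_≤ 1) (trans eq (sym (+-identityʳ (suc k)))) (b F.zero))
      where
        rest-zero : ∀ i → f (F.suc i) ≡ 0
        rest-zero i with f (F.suc i) in e
        ... | zero  = refl
        ... | suc _ with u F.zero (F.suc i) (subst (1 ≤_) (sym eq) (s≤s z≤n)) (subst (1 ≤_) (sym e) (s≤s z≤n))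
        ...   | ()

productSum : ∀ {X Y} → FiniteSum X → FiniteSum Y → FiniteSum (X × Y)
productSum A B = record
  { sum         = λ f → sum A (λ x → sum B (λ y → f (x , y)))
  ; mono        = λ h → mono A (λ x → mono B (λ y → h (x , y)))
  ; additive    = λ f g → trans (sum-cong A (λ x → additive B _ _)) (additive A _ _)
  ; homogeneous = λ c f → trans (sum-cong A (λ x → homogeneous B c _)) (homogeneous A c _)
  ; term≤sum    = λ f p → ≤-trans (term≤sum B (λ y → f (proj₁ p , y)) (proj₂ p)) (term≤sum A _ (proj₁ p))
  ; witness     = λ f h → let (x , hx) = witness A _ h ; (y , hy) = witness B _ hx in (x , y) , hy
  ; atMostOne   = λ f b u → atMostOne A _
      (λ x → atMostOne B _ (λ y → b (x , y)) (λ y y′ p q → cong proj₂ (u _ _ p q)))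
      (λ x x′ p q → let (y , hy) = witness B _ p ; (y′ , hy′) = witness B _ q
                    in cong proj₁ (u _ _ hy hy′))
  }

sumFin-swap : ∀ {Y : Set} N (B : FiniteSum Y) (h : Fin N → Y → ℕ) →
  sumFin N (λ a → sum B (h a)) ≡ sum B (λ b → sumFin N (λ a → h a b))
sumFin-swap zero    B h = sym (sum-zero B _ (λ _ → refl))
sumFin-swap (suc N) B h = trans (cong (sum B (h F.zero) +_) (sumFin-swap N B (λ i → h (F.suc i))))
                                (sym (additive B _ _))

sumFin-swap′ : ∀ {Y : Set} N (B : FiniteSum Y) (h : Y → Fin N → ℕ) →
  sum B (λ b → sumFin N (h b)) ≡ sumFin N (λ a → sum B (λ b → h b a))
sumFin-swap′ N B h = sym (sumFin-swap N B (λ a b → h b a))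

countB-mono : ∀ {N} {f g : Fin N → Bool} → (∀ z → f z ≡ true → g z ≡ true) → countB f ≤ countB g
countB-mono {N} {f} {g} f⇒g = subst₂ _≤_ (sym (countB≡sumFin f)) (sym (countB≡sumFin g)) (mono (finSum N) pointwise)
  where
    pointwise : ∀ z → [ f z ] ≤ [ g z ]
    pointwise z with f z in e
    ... | false = z≤n
    ... | true rewrite f⇒g z e = ≤-refl

doubleCount : ∀ {X Y} (A : FiniteSum X) (B : FiniteSum Y) (h : X → Y → ℕ)
  → sum A (λ a → sum B (h a)) ≡ sum B (λ b → sum A (λ a → h a b))
  → (u : X → ℕ) (v : Y → ℕ) (p q : ℕ)
  → (∀ a → sum B (h a) ≤ p * u a) → (∀ b → q * v b ≤ sum A (λ a → h a b))
  → q * sum B v ≤ p * sum A u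
doubleCount A B h swap u v p q up lo = begin
    q * sum B v                       ≡⟨ homogeneous B q v ⟨
    sum B (λ b → q * v b)             ≤⟨ mono B lo ⟩
    sum B (λ b → sum A (λ a → h a b)) ≡⟨ swap ⟨
    sum A (λ a → sum B (h a))         ≤⟨ mono A up ⟩
    sum A (λ a → p * u a)             ≡⟨ homogeneous A p u ⟩
    p * sum A u                       ∎
  where open ≤-Reasoning

countByMatching : ∀ {X Y} (A : FiniteSum X) (B : FiniteSum Y)
  → (∀ h → sum B (λ b → sum A (h b)) ≡ sum A (λ a → sum B (λ b → h b a)))
  → (P : X → Bool) (Q : Y → Bool) (R : X → Y → Bool)
  → (∀ a → P a ≡ true → ∃ λ b → R a b ≡ true)
  → (∀ a b → P a ≡ true → R a b ≡ true → Q b ≡ true)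
  → (∀ a a′ b → P a ≡ true → R a b ≡ true → P a′ ≡ true → R a′ b ≡ true → a ≡ a′)
  → sum A (λ a → [ P a ]) ≤ sum B (λ b → [ Q b ])
countByMatching A B swap P Q R related preserves unique =
  subst₂ _≤_ (*-identityˡ _) (*-identityˡ _)
    (doubleCount B A (λ b a → [ P a ∧ R a b ]) (swap (λ b a → [ P a ∧ R a b ])) (λ b → [ Q b ]) (λ a → [ P a ]) 1 1
       fibre≤1 1≤fibre)
  where
    fibre≤1 : ∀ b → sum A (λ a → [ P a ∧ R a b ]) ≤ 1 * [ Q b ]
    fibre≤1 b with Q b in eq
    ... | true  = atMostOne A (λ a → [ P a ∧ R a b ]) (λ a → []≤1 (P a ∧ R a b))
                    (λ a a′ p q → let pa = 1≤[]⇒true p ; pa′ = 1≤[]⇒true q in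
                       unique a a′ b (∧-fst pa) (∧-snd pa) (∧-fst pa′) (∧-snd pa′))
    ... | false = ≤-reflexive (sum-zero A _ unrelated)
      where
        unrelated : ∀ a → [ P a ∧ R a b ] ≡ 0
        unrelated a with P a in e₁ | R a b in e₂
        ... | true  | true with trans (sym eq) (preserves a b e₁ e₂)
        ...   | ()
        unrelated a | true  | false = refl
        unrelated a | false | _     = refl
    1≤fibre : ∀ a → 1 * [ P a ] ≤ sum B (λ b → [ P a ∧ R a b ])
    1≤fibre a with P a in e
    ... | false = z≤n
    ... | true with related a e
    ...   | b , r = subst (_≤ sum B (λ b → [ R a b ])) (cong [_] r) (term≤sum B (λ b → [ R a b ]) b)

module Distance {N : ℕ} (G : Graph N) where

  adj-sym : ∀ {a b} → adj G a b ≡ true → adj G b a ≡ true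
  adj-sym {a} {b} h = trans (symm G b a) h

  within-refl : ∀ x → within G 0 x x ≡ true
  within-refl x = eqB-intro {a = x} refl

  within0⇒≡ : ∀ {x y} → within G 0 x y ≡ true → x ≡ y
  within0⇒≡ = eqB⇒≡

  within-suc : ∀ l {x y} → within G l x y ≡ true → within G (suc l) x y ≡ true
  within-suc l h = ∨-introˡ _ h

  within-+ : ∀ d l {x y} → within G l x y ≡ true → within G (d + l) x y ≡ true
  within-+ zero    l h = h
  within-+ (suc d) l h = within-suc (d + l) (within-+ d l h)

  within-mono : ∀ {l l′ x y} → l ≤ l′ → within G l x y ≡ true → within G l′ x y ≡ true
  within-mono {l} {l′} {x} {y} le h =
    subst (λ s → within G s x y ≡ true) (m∸n+n≡m le) (within-+ (l′ ∸ l) l h)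

  within-extend : ∀ l {x z y} → within G l x z ≡ true → adj G z y ≡ true → within G (suc l) x y ≡ true
  within-extend l {x} {z} {y} h a =
    ∨-introʳ (within G l x y) (anyB-intro (λ w → within G l x w ∧ adj G w y) z (∧-intro h a))

  within-suc-inv : ∀ l {x y} → within G (suc l) x y ≡ true
    → within G l x y ≡ true ⊎ ∃ λ z → within G l x z ≡ true × adj G z y ≡ true
  within-suc-inv l {x} {y} h with within G l x y in e
  ... | true  = inj₁ refl
  ... | false with anyB-witness (λ z → within G l x z ∧ adj G z y) h
  ...   | z , p = inj₂ (z , ∧-fst p , ∧-snd p)

  atDist⇒within : ∀ i {x y} → atDist G i x y ≡ true → within G i x y ≡ true
  atDist⇒within zero    h = h
  atDist⇒within (suc i) h = ∧-fst h

  atDist⇒minimal : ∀ i {x y} → atDist G i x y ≡ true → ∀ l → within G l x y ≡ true → i ≤ l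
  atDist⇒minimal zero    h l w = z≤n
  atDist⇒minimal (suc i) h l w with suc i ≤? l
  ... | yes p = p
  ... | no np with trans (sym (within-mono (≤-pred (≰⇒> np)) w)) (not-true (∧-snd h))
  ...   | ()

  minimal⇒atDist : ∀ i {x y} → within G i x y ≡ true → (∀ l → within G l x y ≡ true → i ≤ l)
    → atDist G i x y ≡ true
  minimal⇒atDist zero    w _ = w
  minimal⇒atDist (suc i) {x} {y} w least with within G i x y in e
  ... | true  = ⊥-elim (1+n≰n (least i e))
  ... | false rewrite w = refl

  atDist-unique : ∀ i j {x y} → atDist G i x y ≡ true → atDist G j x y ≡ true → i ≡ j
  atDist-unique i j hi hj =
    ≤-antisym (atDist⇒minimal i hi j (atDist⇒within j hj)) (atDist⇒minimal j hj i (atDist⇒within i hi))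

  distinct-dist : ∀ i j {x y z} → atDist G i x y ≡ true → atDist G j x z ≡ true → i ≢ j → y ≢ z
  distinct-dist i j hy hz i≢j refl = i≢j (atDist-unique i j hy hz)

  no-edge-across : ∀ i j {x y z} → atDist G i x y ≡ true → atDist G j x z ≡ true → suc (suc i) ≤ j
    → adj G y z ≡ true → ⊥
  no-edge-across i j hy hz le a =
    1+n≰n (≤-trans le (atDist⇒minimal j hz (suc i) (within-extend i (atDist⇒within i hy) a)))

  predecessor : ∀ j {x b} → atDist G (suc j) x b ≡ true → ∃ λ t → atDist G j x t ≡ true × adj G t b ≡ true
  predecessor j {x} {b} h with within-suc-inv j (atDist⇒within (suc j) h)
  ... | inj₁ w = ⊥-elim (1+n≰n (atDist⇒minimal (suc j) h j w))
  ... | inj₂ (t , w , a) =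
    t , minimal⇒atDist j w (λ l wl → ≤-pred (atDist⇒minimal (suc j) h (suc l) (within-extend l wl a))) , a

  squeezed : ∀ j {x d u b} → atDist G j x d ≡ true → adj G d u ≡ true
    → atDist G (suc (suc j)) x b ≡ true → adj G b u ≡ true → atDist G (suc j) x u ≡ true
  squeezed j hd du hb bu = minimal⇒atDist (suc j) (within-extend j (atDist⇒within j hd) du)
    (λ l w → ≤-pred (atDist⇒minimal (suc (suc j)) hb (suc l) (within-extend l w (adj-sym bu))))

  adj⇒dist1 : ∀ {x z} → adj G x z ≡ true → atDist G 1 x z ≡ true
  adj⇒dist1 {x} {z} a = minimal⇒atDist 1 (within-extend 0 (within-refl x) a) positive
    where
      positive : ∀ l → within G l x z ≡ true → 1 ≤ l
      positive zero w with within0⇒≡ {x} {z} w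
      ... | refl with trans (sym a) (irrefl G x)
      ...   | ()
      positive (suc l) w = s≤s z≤n

  dist1⇒adj : ∀ {x z} → atDist G 1 x z ≡ true → adj G x z ≡ true
  dist1⇒adj {x} {z} h with predecessor 0 h
  ... | t , ht , a = subst (λ u → adj G u z ≡ true) (sym (within0⇒≡ ht)) a

-- Points of the grid K_n □ K_n; p = (row, column).
Pt : ℕ → Set
Pt n = Fin n × Fin n

module _ {n : ℕ} where

  transpose : Pt n → Pt n
  transpose p = proj₂ p , proj₁ p

  grid-transpose : ∀ {p q : Pt n} → GridAdj p q → GridAdj (transpose p) (transpose q)
  grid-transpose (inj₁ (e , ne)) = inj₂ (ne , e)
  grid-transpose (inj₂ (ne , e)) = inj₁ (e , ne)

  sameRow : ∀ {p q : Pt n} → proj₁ p ≡ proj₁ q → proj₂ p ≢ proj₂ q → GridAdj p q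
  sameRow e ne = inj₁ (e , ne)

  sameCol : ∀ {p q : Pt n} → proj₁ p ≢ proj₁ q → proj₂ p ≡ proj₂ q → GridAdj p q
  sameCol ne e = inj₂ (ne , e)

  nonadjacent : ∀ {p q : Pt n} → proj₁ p ≢ proj₁ q → proj₂ p ≢ proj₂ q → ¬ GridAdj p q
  nonadjacent n₁ n₂ (inj₁ (e , _)) = n₁ e
  nonadjacent n₁ n₂ (inj₂ (_ , e)) = n₂ e

  sameRow⇒col≢ : ∀ {q τ : Pt n} → GridAdj q τ → proj₁ q ≡ proj₁ τ → proj₂ q ≢ proj₂ τ
  sameRow⇒col≢ (inj₁ (_ , ne)) _ = ne
  sameRow⇒col≢ (inj₂ (ne , _)) e = ⊥-elim (ne e)

  row≢⇒sameCol : ∀ {q τ : Pt n} → GridAdj q τ → proj₁ q ≢ proj₁ τ → proj₂ q ≡ proj₂ τ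
  row≢⇒sameCol (inj₁ (e , _)) ne = ⊥-elim (ne e)
  row≢⇒sameCol (inj₂ (_ , e)) _ = e

  commonNeighbour-row : ∀ {p q r : Pt n} → proj₁ p ≡ proj₁ q → proj₂ p ≢ proj₂ q
    → GridAdj r p → GridAdj r q → proj₁ r ≡ proj₁ p
  commonNeighbour-row e ne (inj₁ (e₁ , _)) _                = e₁
  commonNeighbour-row e ne (inj₂ (n₁ , _)) (inj₁ (e₂ , _))  = ⊥-elim (n₁ (trans e₂ (sym e)))
  commonNeighbour-row e ne (inj₂ (_ , e₁)) (inj₂ (_ , e₂))  = ⊥-elim (ne (trans (sym e₁) e₂))

  commonNeighbours-adjacent : ∀ {p q r r′ : Pt n} → GridAdj p q → GridAdj r p → GridAdj r q
    → GridAdj r′ p → GridAdj r′ q → r ≢ r′ → GridAdj r r′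
  commonNeighbours-adjacent (inj₁ (e , ne)) a₁ a₂ a₃ a₄ r≢r′ =
    let same = trans (commonNeighbour-row e ne a₁ a₂) (sym (commonNeighbour-row e ne a₃ a₄))
    in inj₁ (same , λ z → r≢r′ (cong₂ _,_ same z))
  commonNeighbours-adjacent (inj₂ (ne , e)) a₁ a₂ a₃ a₄ r≢r′ =
    let same = trans (commonNeighbour-row e ne (grid-transpose a₁) (grid-transpose a₂))
                     (sym (commonNeighbour-row e ne (grid-transpose a₃) (grid-transpose a₄)))
    in inj₂ ((λ z → r≢r′ (cong₂ _,_ z same)) , same)

  rowNeighbour-row : ∀ {q q₀ τ : Pt n} → GridAdj q τ → GridAdj q₀ τ → proj₁ q₀ ≡ proj₁ τ
    → (GridAdj q q₀ ⊎ q ≡ q₀) → proj₁ q ≡ proj₁ τ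
  rowNeighbour-row (inj₁ (e , _)) _ _ _ = e
  rowNeighbour-row (inj₂ (n₁ , _)) _ e₀ (inj₂ refl) = ⊥-elim (n₁ e₀)
  rowNeighbour-row (inj₂ (n₁ , e₁)) (inj₁ (_ , n₀)) e₀ (inj₁ a) =
    ⊥-elim (nonadjacent (λ z → n₁ (trans z e₀)) (λ z → n₀ (trans (sym z) e₁)) a)
  rowNeighbour-row (inj₂ _) (inj₂ (n₀ , _)) e₀ (inj₁ _) = ⊥-elim (n₀ e₀)

  awayFromColumn-row : ∀ {q q₀ τ : Pt n} → GridAdj q τ → proj₂ q₀ ≡ proj₂ τ
    → ¬ GridAdj q q₀ → q ≢ q₀ → proj₁ q ≡ proj₁ τ
  awayFromColumn-row (inj₁ (e , _)) _ _ _ = e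
  awayFromColumn-row {q} {q₀} (inj₂ (_ , e₁)) e₀ na nq with proj₁ q F.≟ proj₁ q₀
  ... | yes p = ⊥-elim (nq (cong₂ _,_ p (trans e₁ (sym e₀))))
  ... | no np = ⊥-elim (na (inj₂ (np , trans e₁ (sym e₀))))

  sameRow-near : ∀ {q p : Pt n} → proj₁ q ≡ proj₁ p → q ≡ p ⊎ GridAdj q p
  sameRow-near {q} {p} e with proj₂ q F.≟ proj₂ p
  ... | yes e′ = inj₁ (cong₂ _,_ e e′)
  ... | no ne  = inj₂ (sameRow e ne)

  sameCol-near : ∀ {q p : Pt n} → proj₂ q ≡ proj₂ p → q ≡ p ⊎ GridAdj q p
  sameCol-near {q} {p} e with proj₁ q F.≟ proj₁ p
  ... | yes e′ = inj₁ (cong₂ _,_ e′ e)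
  ... | no ne  = inj₂ (sameCol ne e)

another : ∀ {n} → 2 ≤ n → (i : Fin n) → ∃ λ j → j ≢ i
another (s≤s (s≤s _)) F.zero    = F.suc F.zero , λ ()
another (s≤s (s≤s _)) (F.suc i) = F.zero , λ ()

module Labelling {N n : ℕ} (G : Graph N) {a : Fin N} (L : LocallyGridAt n G a) where
  f : Pt n → Fin N
  f = proj₁ L

  f-injective : ∀ p q → f p ≡ f q → p ≡ q
  f-injective = proj₁ (proj₂ L)

  centre-adj : ∀ p → adj G a (f p) ≡ true
  centre-adj = proj₁ (proj₂ (proj₂ L))

  f-onto : ∀ y → adj G a y ≡ true → ∃ λ p → f p ≡ y
  f-onto = proj₁ (proj₂ (proj₂ (proj₂ L)))

  toGrid : ∀ p q → adj G (f p) (f q) ≡ true → GridAdj p q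
  toGrid p q = Equivalence.to (proj₂ (proj₂ (proj₂ (proj₂ L))) p q)

  fromGrid : ∀ p q → GridAdj p q → adj G (f p) (f q) ≡ true
  fromGrid p q = Equivalence.from (proj₂ (proj₂ (proj₂ (proj₂ L))) p q)

  toGrid′ : ∀ {p q u v} → f p ≡ u → f q ≡ v → adj G u v ≡ true → GridAdj p q
  toGrid′ {p} {q} refl refl = toGrid p q

  fromGrid′ : ∀ {p q u v} → f p ≡ u → f q ≡ v → GridAdj p q → adj G u v ≡ true
  fromGrid′ {p} {q} refl refl = fromGrid p q

transposed : ∀ {N n} (G : Graph N) {a : Fin N} → LocallyGridAt n G a → LocallyGridAt n G a
transposed G L =
  (λ p → f (transpose p)) ,
  (λ p q e → cong transpose (f-injective (transpose p) (transpose q) e)) ,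
  (λ p → centre-adj (transpose p)) ,
  (λ y h → let (p , e) = f-onto y h in transpose p , e) ,
  (λ p q → record
     { to = λ h → grid-transpose (toGrid (transpose p) (transpose q) h)
     ; from = λ g → fromGrid (transpose p) (transpose q) (grid-transpose g)
     ; to-cong = λ { refl → refl } ; from-cong = λ { refl → refl } })
  where open Labelling G L

gridSum : ∀ n → FiniteSum (Pt n)
gridSum n = productSum (finSum n) (finSum n)

gridCount : ∀ {n} → (Pt n → Bool) → ℕ
gridCount {n} τ = sum (gridSum n) (λ p → [ τ p ])

rowsHit : ∀ {n} → (Pt n → Bool) → ℕ
rowsHit {n} τ = sumFin n (λ i → [ anyB (λ c → τ (i , c)) ])

count-not : ∀ n (R : Fin n → Bool) → sumFin n (λ i → [ not (R i) ]) ≡ n ∸ sumFin n (λ i → [ R i ])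
count-not n R = begin
    #¬R               ≡⟨ m+n∸n≡m #¬R #R ⟨
    #¬R + #R ∸ #R     ≡⟨ cong (_∸ #R) (additive (finSum n) _ _) ⟨
    sumFin n (λ i → [ not (R i) ] + [ R i ]) ∸ #R
                      ≡⟨ cong (_∸ #R) (trans (sum-cong (finSum n) (λ i → complement (R i)))
                                              (trans (sumFin-const n 1) (*-identityʳ n))) ⟩
    n ∸ #R            ∎
  where
    open ≡-Reasoning
    #R #¬R : ℕ
    #R = sumFin n (λ i → [ R i ])
    #¬R = sumFin n (λ i → [ not (R i) ])
    complement : ∀ b → [ not b ] + [ b ] ≡ 1
    complement true  = refl
    complement false = refl

gridCount-rectangle : ∀ n (A B : Fin n → Bool) →
  gridCount (λ p → A (proj₁ p) ∧ B (proj₂ p)) ≡ sumFin n (λ i → [ A i ]) * sumFin n (λ i → [ B i ])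
gridCount-rectangle n A B = begin
    sumFin n (λ i → sumFin n (λ c → [ A i ∧ B c ]))    ≡⟨ sum-cong (finSum n) (λ i → sum-cong (finSum n) (λ c → [∧] (A i) (B c))) ⟩
    sumFin n (λ i → sumFin n (λ c → [ A i ] * [ B c ])) ≡⟨ sum-cong (finSum n) (λ i → homogeneous (finSum n) [ A i ] _) ⟩
    sumFin n (λ i → [ A i ] * #B)                       ≡⟨ sum-cong (finSum n) (λ i → *-comm [ A i ] #B) ⟩
    sumFin n (λ i → #B * [ A i ])                       ≡⟨ homogeneous (finSum n) #B (λ i → [ A i ]) ⟩
    #B * #A                                             ≡⟨ *-comm #B #A ⟩
    #A * #B                                             ∎
  where
    open ≡-Reasoning
    #A #B : ℕ
    #A = sumFin n (λ i → [ A i ])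
    #B = sumFin n (λ i → [ B i ])

atMostTwo : ∀ n (P : Fin n → Bool)
  → (∀ c₀ c₁ c₂ → c₀ ≢ c₁ → c₀ ≢ c₂ → c₁ ≢ c₂ → P c₀ ≡ true → P c₁ ≡ true → P c₂ ≡ true → ⊥)
  → sumFin n (λ c → [ P c ]) ≤ 2 * [ anyB P ]
atMostTwo n P noThree with anyB P in any
... | false = ≤-reflexive (sum-zero (finSum n) _ nowhere)
  where
    nowhere : ∀ c → [ P c ] ≡ 0
    nowhere c with P c in e
    ... | false = refl
    ... | true with trans (sym (anyB-intro P c e)) any
    ...   | ()
... | true = let (c₀ , h₀) = anyB-witness P any in begin
    sumFin n (λ c → [ P c ])                                          ≤⟨ mono (finSum n) (split c₀) ⟩
    sumFin n (λ c → [ eqB c c₀ ] + [ not (eqB c c₀) ∧ P c ])          ≡⟨ additive (finSum n) _ _ ⟩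
    sumFin n (λ c → [ eqB c c₀ ]) + sumFin n (λ c → [ not (eqB c c₀) ∧ P c ])
                                                                      ≤⟨ +-mono-≤ (single c₀) (others c₀ h₀) ⟩
    2                                                                 ∎
  where
    open ≤-Reasoning
    split : ∀ c₀ c → [ P c ] ≤ [ eqB c c₀ ] + [ not (eqB c c₀) ∧ P c ]
    split c₀ c with eqB c c₀
    ... | true  = ≤-trans ([]≤1 (P c)) (m≤m+n 1 _)
    ... | false = ≤-refl
    single : ∀ c₀ → sumFin n (λ c → [ eqB c c₀ ]) ≤ 1
    single c₀ = atMostOne (finSum n) _ (λ c → []≤1 (eqB c c₀))
      (λ c c′ p q → trans (eqB⇒≡ (1≤[]⇒true p)) (sym (eqB⇒≡ (1≤[]⇒true q))))
    others : ∀ c₀ → P c₀ ≡ true → sumFin n (λ c → [ not (eqB c c₀) ∧ P c ]) ≤ 1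
    others c₀ h₀ = atMostOne (finSum n) _ (λ c → []≤1 (not (eqB c c₀) ∧ P c)) unique
      where
        ≢c₀ : ∀ {c} → 1 ≤ [ not (eqB c c₀) ∧ P c ] → c₀ ≢ c
        ≢c₀ {c} p e with trans (sym (not-true (∧-fst (1≤[]⇒true p)))) (eqB-intro (sym e))
        ... | ()
        unique : ∀ c c′ → 1 ≤ [ not (eqB c c₀) ∧ P c ] → 1 ≤ [ not (eqB c′ c₀) ∧ P c′ ] → c ≡ c′
        unique c c′ p q with c F.≟ c′
        ... | yes e = e
        ... | no ne = ⊥-elim (noThree c₀ c c′ (≢c₀ p) (≢c₀ q) ne h₀
                        (∧-snd {not (eqB c c₀)} (1≤[]⇒true p)) (∧-snd {not (eqB c′ c₀)} (1≤[]⇒true q)))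

denseGridSet : ∀ {n} s (τ : Pt n → Bool) p₀ → τ p₀ ≡ true
  → (∀ p → τ p ≡ true → s ≤ sumFin n (λ c → [ τ (proj₁ p , c) ]))
  → (∀ p → τ p ≡ true → s ≤ sumFin n (λ i → [ τ (i , proj₂ p) ]))
  → (s * s ≤ gridCount τ) × (s ≤ rowsHit τ)
denseGridSet {n} s τ p₀ h₀ rowDense colDense = square , rows
  where
    open ≤-Reasoning
    column₀ : s ≤ sumFin n (λ i → [ τ (i , proj₂ p₀) ])
    column₀ = colDense p₀ h₀
    -- every point of the column through p₀ contributes a full row
    square : s * s ≤ gridCount τ
    square = begin
      s * s                                         ≤⟨ *-monoʳ-≤ s column₀ ⟩
      s * sumFin n (λ i → [ τ (i , proj₂ p₀) ])     ≡⟨ homogeneous (finSum n) s _ ⟨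
      sumFin n (λ i → s * [ τ (i , proj₂ p₀) ])     ≤⟨ mono (finSum n) rowOf ⟩
      sumFin n (λ i → sumFin n (λ c → [ τ (i , c) ])) ∎
      where
        rowOf : ∀ i → s * [ τ (i , proj₂ p₀) ] ≤ sumFin n (λ c → [ τ (i , c) ])
        rowOf i with τ (i , proj₂ p₀) in e
        ... | false = ≤-trans (≤-reflexive (*-zeroʳ s)) z≤n
        ... | true  = ≤-trans (≤-reflexive (*-identityʳ s)) (rowDense (i , proj₂ p₀) e)
    rows : s ≤ rowsHit τ
    rows = ≤-trans column₀ (mono (finSum n) hit)
      where
        hit : ∀ i → [ τ (i , proj₂ p₀) ] ≤ [ anyB (λ c → τ (i , c)) ]
        hit i with τ (i , proj₂ p₀) in e
        ... | false = z≤n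
        ... | true rewrite anyB-intro (λ c → τ (i , c)) (proj₂ p₀) e = ≤-refl

count-remove : ∀ n (T : Fin n → Bool) c₀ → T c₀ ≡ true
  → suc (sumFin n (λ c → [ not (eqB c c₀) ∧ T c ])) ≤ sumFin n (λ c → [ T c ])
count-remove n T c₀ h₀ = begin
    1 + sumFin n (λ c → [ not (eqB c c₀) ∧ T c ])
        ≤⟨ +-monoˡ-≤ _ (subst (λ b → [ b ] ≤ sumFin n (λ c → [ eqB c c₀ ])) (eqB-intro {a = c₀} refl) (term≤sum (finSum n) (λ c → [ eqB c c₀ ]) c₀)) ⟩
    sumFin n (λ c → [ eqB c c₀ ]) + sumFin n (λ c → [ not (eqB c c₀) ∧ T c ])
        ≡⟨ additive (finSum n) _ _ ⟨
    sumFin n (λ c → [ eqB c c₀ ] + [ not (eqB c c₀) ∧ T c ])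
        ≤⟨ mono (finSum n) pointwise ⟩
    sumFin n (λ c → [ T c ]) ∎
  where
    open ≤-Reasoning
    pointwise : ∀ c → [ eqB c c₀ ] + [ not (eqB c c₀) ∧ T c ] ≤ [ T c ]
    pointwise c with eqB c c₀ in e
    ... | false = ≤-refl
    ... | true rewrite eqB⇒≡ e | h₀ = ≤-refl

layerNeighbours : ∀ {N} → Graph N → Fin N → ℕ → Fin N → ℕ
layerNeighbours G x l v = countB (λ w → adj G v w ∧ atDist G l x w)

layerCount : ∀ {N} (G : Graph N) x i (up lo : ℕ)
  → (∀ a → atDist G i x a ≡ true → layerNeighbours G x (suc i) a ≤ up)
  → (∀ b → atDist G (suc i) x b ≡ true → lo ≤ layerNeighbours G x i b)
  → lo * k G (suc i) x ≤ up * k G i x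
layerCount {N} G x i up lo upper lower =
  subst₂ (λ s t → lo * s ≤ up * t) (sym (countB≡sumFin (atDist G (suc i) x))) (sym (countB≡sumFin (atDist G i x)))
    (doubleCount (finSum N) (finSum N) edge (sumFin-swap N (finSum N) edge)
       (λ a → [ atDist G i x a ]) (λ b → [ atDist G (suc i) x b ]) up lo upperₐ lowerᵦ)
  where
    edge : Fin N → Fin N → ℕ
    edge a b = [ atDist G i x a ∧ (adj G a b ∧ atDist G (suc i) x b) ]
    upperₐ : ∀ a → sumFin N (edge a) ≤ up * [ atDist G i x a ]
    upperₐ a with atDist G i x a in e
    ... | false = ≤-trans (≤-reflexive (sum-zero (finSum N) _ (λ _ → refl))) z≤n
    ... | true  = subst₂ _≤_ (countB≡sumFin (λ b → adj G a b ∧ atDist G (suc i) x b)) (sym (*-identityʳ up)) (upper a e)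
    lowerᵦ : ∀ b → lo * [ atDist G (suc i) x b ] ≤ sumFin N (λ a → edge a b)
    lowerᵦ b with atDist G (suc i) x b in e
    ... | false = ≤-trans (≤-reflexive (*-zeroʳ lo)) z≤n
    ... | true  = subst₂ _≤_ (sym (*-identityʳ lo))
                    (trans (countB≡sumFin (λ a → adj G b a ∧ atDist G i x a)) (sum-cong (finSum N) reorder)) (lower b e)
      where
        reorder : ∀ a → [ adj G b a ∧ atDist G i x a ] ≡ [ atDist G i x a ∧ (adj G a b ∧ true) ]
        reorder a rewrite symm G b a | ∧-comm (adj G a b) true = cong [_] (∧-comm (adj G a b) (atDist G i x a))

labelledCount : ∀ {N n} (G : Graph N) {a} (L : LocallyGridAt n G a) (P : Fin N → Bool)
  → countB (λ z → adj G a z ∧ P z) ≡ gridCount (λ p → P (Labelling.f G L p))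
labelledCount {N} {n} G {a} L P = trans (countB≡sumFin (λ z → adj G a z ∧ P z)) (≤-antisym
    (countByMatching (finSum N) (gridSum n) (sumFin-swap′ N (gridSum n))
       (λ z → adj G a z ∧ P z) (λ p → P (f p)) (λ z p → eqB (f p) z)
       (λ z h → let (p , e) = f-onto z (∧-fst h) in p , eqB-intro e)
       (λ z p h r → subst (λ w → P w ≡ true) (sym (eqB⇒≡ r)) (∧-snd {adj G a z} h))
       (λ z z′ p _ r _ r′ → trans (sym (eqB⇒≡ r)) (eqB⇒≡ r′)))
    (countByMatching (gridSum n) (finSum N) (sumFin-swap N (gridSum n))
       (λ p → P (f p)) (λ z → adj G a z ∧ P z) (λ p z → eqB (f p) z)
       (λ p _ → f p , eqB-intro refl)
       (λ p z h r → subst (λ w → (adj G a w ∧ P w) ≡ true) (eqB⇒≡ r) (∧-intro (centre-adj p) h))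
       (λ p p′ z _ r _ r′ → f-injective p p′ (trans (eqB⇒≡ r) (sym (eqB⇒≡ r′))))))
  where open Labelling G L

-- Let t = f_B(τ₀) be a neighbour of b.  The n − 1 common neighbours of b and t
-- on one line through b in the grid at t form, in the grid at b, the line
-- through τ₀ minus τ₀; after possibly transposing the labelling at t, that line
-- is the column of b and the row of τ₀.
module LineTransfer {N n : ℕ} (G : Graph N) (LG : LocallyGrid n G) (n≥2 : 2 ≤ n)
                    {b : Fin N} (B : LocallyGridAt n G b) (τ₀ : Pt n) where
  open Distance G
  private
    module LB = Labelling G B
    t : Fin N
    t = LB.f τ₀
    module LT = Labelling G (LG t)

  ColumnIntoRow : (T : LocallyGridAt n G t) → Pt n → Set
  ColumnIntoRow T β = ∀ ρ → ρ ≢ proj₁ β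
    → ∃ λ c → c ≢ proj₂ τ₀ × LB.f (proj₁ τ₀ , c) ≡ Labelling.f G T (ρ , proj₂ β)

  private
    β : Pt n
    β = proj₁ (LT.f-onto b (adj-sym (LB.centre-adj τ₀)))

    b≡Tβ : LT.f β ≡ b
    b≡Tβ = proj₂ (LT.f-onto b (adj-sym (LB.centre-adj τ₀)))

    -- a T-neighbour of β is a common neighbour of b and t, so its B-preimage is a neighbour of τ₀
    preimage : ∀ π → GridAdj β π → ∃ λ q → LB.f q ≡ LT.f π × GridAdj q τ₀
    preimage π g = let (q , e) = LB.f-onto (LT.f π) (LT.fromGrid′ b≡Tβ refl g)
                   in q , e , LB.toGrid′ e refl (adj-sym (LT.centre-adj π))

    inRow : ∀ {q u} → LB.f q ≡ u → proj₁ q ≡ proj₁ τ₀ → GridAdj q τ₀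
      → ∃ λ c → c ≢ proj₂ τ₀ × LB.f (proj₁ τ₀ , c) ≡ u
    inRow {q} e row qτ = proj₂ q , sameRow⇒col≢ qτ row , trans (cong (λ r → LB.f (r , proj₂ q)) (sym row)) e

    ρ₀ : Fin n
    ρ₀ = proj₁ (another n≥2 (proj₁ β))

    ρ₀≢β₁ : ρ₀ ≢ proj₁ β
    ρ₀≢β₁ = proj₂ (another n≥2 (proj₁ β))

    q₀ : Pt n
    q₀ = proj₁ (preimage (ρ₀ , proj₂ β) (sameCol (λ z → ρ₀≢β₁ (sym z)) refl))

    q₀-label : LB.f q₀ ≡ LT.f (ρ₀ , proj₂ β)
    q₀-label = proj₁ (proj₂ (preimage (ρ₀ , proj₂ β) (sameCol (λ z → ρ₀≢β₁ (sym z)) refl)))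

    q₀τ₀ : GridAdj q₀ τ₀
    q₀τ₀ = proj₂ (proj₂ (preimage (ρ₀ , proj₂ β) (sameCol (λ z → ρ₀≢β₁ (sym z)) refl)))

    column-near-q₀ : ∀ ρ {q} → LB.f q ≡ LT.f (ρ , proj₂ β) → GridAdj q q₀ ⊎ q ≡ q₀
    column-near-q₀ ρ {q} e with ρ F.≟ ρ₀
    ... | yes refl = inj₂ (LB.f-injective q q₀ (trans e (sym q₀-label)))
    ... | no ne    = inj₁ (LB.toGrid′ e q₀-label (LT.fromGrid _ _ (sameCol ne refl)))

    row-away-q₀ : ∀ ρ {q} → ρ ≢ proj₂ β → LB.f q ≡ LT.f (proj₁ β , ρ) → ¬ GridAdj q q₀ × q ≢ q₀
    row-away-q₀ ρ {q} ρ≢β₂ e = ¬adj , ≢q₀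
      where
        ¬adj : ¬ GridAdj q q₀
        ¬adj g = nonadjacent (λ z → ρ₀≢β₁ (sym z)) ρ≢β₂
                   (LT.toGrid _ _ (subst₂ (λ u v → adj G u v ≡ true) e q₀-label (LB.fromGrid q q₀ g)))
        ≢q₀ : q ≢ q₀
        ≢q₀ q≡q₀ = ρ₀≢β₁ (sym (cong proj₁ (LT.f-injective _ _ (trans (sym e) (trans (cong LB.f q≡q₀) q₀-label)))))

    columnFollows : proj₁ q₀ ≡ proj₁ τ₀ → ColumnIntoRow (LG t) β
    columnFollows row₀ ρ ρ≢β₁ with preimage (ρ , proj₂ β) (sameCol (λ z → ρ≢β₁ (sym z)) refl)
    ... | q , e , qτ = inRow e (rowNeighbour-row qτ q₀τ₀ row₀ (column-near-q₀ ρ e)) qτ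

    -- otherwise q₀ lies in the column of τ₀, and the row of β goes to the row of τ₀
    rowFollows : proj₁ q₀ ≢ proj₁ τ₀ → ColumnIntoRow (transposed G (LG t)) (transpose β)
    rowFollows ¬row₀ ρ ρ≢β₂ with preimage (proj₁ β , ρ) (sameRow refl (λ z → ρ≢β₂ (sym z)))
    ... | q , e , qτ = let (¬adj , ≢q₀) = row-away-q₀ ρ ρ≢β₂ e in
      inRow e (awayFromColumn-row qτ (row≢⇒sameCol q₀τ₀ ¬row₀) ¬adj ≢q₀) qτ

  lineTransfer : ∃ λ (T : LocallyGridAt n G t) → ∃ λ β → Labelling.f G T β ≡ b × ColumnIntoRow T β
  lineTransfer with proj₁ q₀ F.≟ proj₁ τ₀
  ... | yes row₀ = LG t , β , b≡Tβ , columnFollows row₀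
  ... | no ¬row₀ = transposed G (LG t) , transpose β , b≡Tβ , rowFollows ¬row₀

module AroundVertex {N n : ℕ} (G : Graph N) (LG : LocallyGrid n G) (x : Fin N) where
  open Distance G

  rowsMeeting : ∀ {a} → LocallyGridAt n G a → ℕ → ℕ
  rowsMeeting L j = rowsHit (λ p → atDist G j x (Labelling.f G L p))

  clearLine : ∀ j {a} (L : LocallyGridAt n G a) {p q} → atDist G (suc (suc j)) x (Labelling.f G L p) ≡ true
    → (q ≡ p ⊎ GridAdj q p) → atDist G j x (Labelling.f G L q) ≡ true → ⊥
  clearLine j L {p} hp (inj₁ refl) hq = distinct-dist j (suc (suc j)) hq hp (<⇒≢ (s≤s (n≤1+n j))) refl
  clearLine j L {p} {q} hp (inj₂ g) hq = no-edge-across j (suc (suc j)) hq hp ≤-refl (Labelling.fromGrid G L q p g)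

  -- A vertex a with at least r rows and r columns of its grid meeting Γ_j(x)
  -- has at most (n − r)² neighbours in Γ_{j+2}(x): these avoid all such lines.
  forwardBound : ∀ j {a} (L : LocallyGridAt n G a) r → r ≤ rowsMeeting L j → r ≤ rowsMeeting (transposed G L) j
    → layerNeighbours G x (suc (suc j)) a ≤ (n ∸ r) * (n ∸ r)
  forwardBound j {a} L r rows cols = begin
      layerNeighbours G x (suc (suc j)) a              ≡⟨ labelledCount G L (atDist G (suc (suc j)) x) ⟩
      gridCount (λ p → atDist G (suc (suc j)) x (f p)) ≤⟨ mono (gridSum n) avoid ⟩
      gridCount (λ p → not (rowHit (proj₁ p)) ∧ not (colHit (proj₂ p)))
                                                       ≡⟨ gridCount-rectangle n (λ i → not (rowHit i)) (λ c → not (colHit c)) ⟩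
      sumFin n (λ i → [ not (rowHit i) ]) * sumFin n (λ c → [ not (colHit c) ])
                                                       ≡⟨ cong₂ _*_ (count-not n rowHit) (count-not n colHit) ⟩
      (n ∸ rowsMeeting L j) * (n ∸ rowsMeeting (transposed G L) j)
                                                       ≤⟨ *-mono-≤ (∸-monoʳ-≤ n rows) (∸-monoʳ-≤ n cols) ⟩
      (n ∸ r) * (n ∸ r)                                ∎
    where
      open ≤-Reasoning
      open Labelling G L
      rowHit colHit : Fin n → Bool
      rowHit i = anyB (λ c → atDist G j x (f (i , c)))
      colHit c = anyB (λ i → atDist G j x (f (i , c)))
      avoid : ∀ p → [ atDist G (suc (suc j)) x (f p) ] ≤ [ not (rowHit (proj₁ p)) ∧ not (colHit (proj₂ p)) ]
      avoid p with atDist G (suc (suc j)) x (f p) in hp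
      ... | false = z≤n
      ... | true  = ≤-reflexive (cong [_] (sym (∧-intro
            (not-intro λ h → let (c , hc) = anyB-witness (λ c → atDist G j x (f (proj₁ p , c))) h
                             in clearLine j L hp (sameRow-near refl) hc)
            (not-intro λ h → let (i , hi) = anyB-witness (λ i → atDist G j x (f (i , proj₂ p))) h
                             in clearLine j L hp (sameCol-near refl) hi))))

  rowsMeeting-dist1 : ∀ {a} → adj G x a ≡ true → (L : LocallyGridAt n G a) → 1 ≤ rowsMeeting L 0
  rowsMeeting-dist1 hxa L =
    ≤-trans (≤-reflexive (cong [_] (sym hitsRow)))
            (term≤sum (finSum n) (λ i → [ anyB (λ c → atDist G 0 x (f (i , c))) ]) (proj₁ p))
    where
      open Labelling G L
      px : ∃ λ p → f p ≡ x
      px = f-onto x (adj-sym hxa)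
      p : Pt n
      p = proj₁ px
      hitsRow : anyB (λ c → atDist G 0 x (f (proj₁ p , c))) ≡ true
      hitsRow = anyB-intro _ (proj₂ p) (subst (λ w → atDist G 0 x w ≡ true) (sym (proj₂ px)) (within-refl x))

  k₁≤n² : k G 1 x ≤ n * n
  k₁≤n² = begin
      k G 1 x                                   ≤⟨ countB-mono {g = λ z → adj G x z ∧ true} (λ z h → ∧-intro (dist1⇒adj h) refl) ⟩
      countB (λ z → adj G x z ∧ true)           ≡⟨ labelledCount G (LG x) (λ _ → true) ⟩
      gridCount {n} (λ _ → true ∧ true)         ≡⟨ gridCount-rectangle n (λ _ → true) (λ _ → true) ⟩
      sumFin n (λ _ → 1) * sumFin n (λ _ → 1)   ≡⟨ cong (λ s → s * s) (trans (sumFin-const n 1) (*-identityʳ n)) ⟩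
      n * n                                     ∎
    where open ≤-Reasoning

  -- For a at distance 2, no three labels in one row of the grid at a are
  -- adjacent to x: in the grid at one of them, x and a would be two distinct
  -- common neighbours of the other two, hence adjacent.
  noThreeInRow : ∀ {a} → atDist G 2 x a ≡ true → (L : LocallyGridAt n G a) → ∀ i c₀ c₁ c₂
    → c₀ ≢ c₁ → c₀ ≢ c₂ → c₁ ≢ c₂
    → atDist G 1 x (Labelling.f G L (i , c₀)) ≡ true → atDist G 1 x (Labelling.f G L (i , c₁)) ≡ true
    → atDist G 1 x (Labelling.f G L (i , c₂)) ≡ true → ⊥
  noThreeInRow {a} ha L i c₀ c₁ c₂ n₀₁ n₀₂ n₁₂ h₀ h₁ h₂ =
      no-edge-across 0 2 (within-refl x) ha ≤-refl
        (LZ.fromGrid′ x-label a-label (commonNeighbours-adjacent s₁s₂ xs₁ xs₂ as₁ as₂ x≢a))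
    where
      open Labelling G L
      module LZ = Labelling G (LG (f (i , c₀)))
      xp : ∃ λ p → LZ.f p ≡ x
      xp = LZ.f-onto x (adj-sym (dist1⇒adj h₀))
      ap : ∃ λ p → LZ.f p ≡ a
      ap = LZ.f-onto a (adj-sym (centre-adj (i , c₀)))
      s₁p : ∃ λ p → LZ.f p ≡ f (i , c₁)
      s₁p = LZ.f-onto (f (i , c₁)) (fromGrid _ _ (sameRow refl n₀₁))
      s₂p : ∃ λ p → LZ.f p ≡ f (i , c₂)
      s₂p = LZ.f-onto (f (i , c₂)) (fromGrid _ _ (sameRow refl n₀₂))
      x-label : LZ.f (proj₁ xp) ≡ x
      x-label = proj₂ xp
      a-label : LZ.f (proj₁ ap) ≡ a
      a-label = proj₂ ap
      s₁s₂ : GridAdj (proj₁ s₁p) (proj₁ s₂p)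
      s₁s₂ = LZ.toGrid′ (proj₂ s₁p) (proj₂ s₂p) (fromGrid _ _ (sameRow refl n₁₂))
      xs₁ : GridAdj (proj₁ xp) (proj₁ s₁p)
      xs₁ = LZ.toGrid′ x-label (proj₂ s₁p) (dist1⇒adj h₁)
      xs₂ : GridAdj (proj₁ xp) (proj₁ s₂p)
      xs₂ = LZ.toGrid′ x-label (proj₂ s₂p) (dist1⇒adj h₂)
      as₁ : GridAdj (proj₁ ap) (proj₁ s₁p)
      as₁ = LZ.toGrid′ a-label (proj₂ s₁p) (centre-adj (i , c₁))
      as₂ : GridAdj (proj₁ ap) (proj₁ s₂p)
      as₂ = LZ.toGrid′ a-label (proj₂ s₂p) (centre-adj (i , c₂))
      x≢a : proj₁ xp ≢ proj₁ ap
      x≢a e = distinct-dist 0 2 (within-refl x) ha (λ ()) (trans (sym x-label) (trans (cong LZ.f e) a-label))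

  -- If c₂(x, a) ≥ 2m for a at distance 2, then Γ(x) ∩ Γ(a) meets at least m
  -- rows of any grid at a, since each row holds at most two of its points.
  rowsMeeting-dist2 : ∀ m {a} → atDist G 2 x a ≡ true → 2 * m ≤ c₂ G x a
    → (L : LocallyGridAt n G a) → m ≤ rowsMeeting L 1
  rowsMeeting-dist2 m {a} ha c₂≥2m L = *-cancelˡ-≤ 2 (begin
      2 * m                                        ≤⟨ c₂≥2m ⟩
      c₂ G x a                                     ≤⟨ countB-mono {g = λ z → adj G a z ∧ atDist G 1 x z} (λ z h → ∧-intro (∧-snd {adj G x z} h) (adj⇒dist1 (∧-fst h))) ⟩
      layerNeighbours G x 1 a                      ≡⟨ labelledCount G L (atDist G 1 x) ⟩
      gridCount (λ p → atDist G 1 x (f p))         ≤⟨ mono (finSum n) (λ i → atMostTwo n _ (noThreeInRow ha L i)) ⟩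
      sumFin n (λ i → 2 * [ anyB (λ c → atDist G 1 x (f (i , c))) ])
                                                   ≡⟨ homogeneous (finSum n) 2 _ ⟩
      2 * rowsMeeting L 1                          ∎)
    where
      open ≤-Reasoning
      open Labelling G L

  module Induction (m : ℕ) (n≥2 : 2 ≤ n) where

    RowProperty : ℕ → Set
    RowProperty j = ∀ {t} → atDist G (suc j) x t ≡ true → (L : LocallyGridAt n G t) → m ≤ rowsMeeting L j

    -- For b ∈ Γ_{j+2}(x) and a label τ₀ of a vertex t ∈ Γ_{j+1}(x), the row of
    -- τ₀ holds at least m + 1 labels in Γ_{j+1}(x): τ₀ itself, and, for each row
    -- of a grid at t meeting Γ_j(x), its point in the column of b (lineTransfer).
    rowThroughPredecessor : ∀ j → RowProperty j → ∀ {b} → atDist G (suc (suc j)) x b ≡ true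
      → (B : LocallyGridAt n G b) → ∀ τ₀ → atDist G (suc j) x (Labelling.f G B τ₀) ≡ true
      → suc m ≤ sumFin n (λ c → [ atDist G (suc j) x (Labelling.f G B (proj₁ τ₀ , c)) ])
    rowThroughPredecessor j rowProp {b} hb B τ₀ ht = begin
        suc m                               ≤⟨ s≤s (≤-trans (rowProp ht T) matching) ⟩
        suc (sumFin n (λ c → [ others c ])) ≤⟨ count-remove n inRow (proj₂ τ₀) ht ⟩
        sumFin n (λ c → [ inRow c ])        ∎
      where
        open ≤-Reasoning
        module LB = Labelling G B
        open LineTransfer G LG n≥2 B τ₀ using (ColumnIntoRow; lineTransfer)
        T : LocallyGridAt n G (LB.f τ₀)
        T = proj₁ lineTransfer
        module LT = Labelling G T
        β : Pt n
        β = proj₁ (proj₂ lineTransfer)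
        b≡Tβ : LT.f β ≡ b
        b≡Tβ = proj₁ (proj₂ (proj₂ lineTransfer))
        columnIntoRow : ColumnIntoRow T β
        columnIntoRow = proj₂ (proj₂ (proj₂ lineTransfer))

        inRow others rowHit : Fin n → Bool
        inRow c = atDist G (suc j) x (LB.f (proj₁ τ₀ , c))
        others c = not (eqB c (proj₂ τ₀)) ∧ inRow c
        rowHit ρ = anyB (λ c → atDist G j x (LT.f (ρ , c)))

        hb′ : atDist G (suc (suc j)) x (LT.f β) ≡ true
        hb′ = subst (λ w → atDist G (suc (suc j)) x w ≡ true) (sym b≡Tβ) hb

        columnPoint : ∀ ρ → rowHit ρ ≡ true → (ρ ≢ proj₁ β) × atDist G (suc j) x (LT.f (ρ , proj₂ β)) ≡ true
        columnPoint ρ hit =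
            ρ≢β₁ , squeezed j hd (LT.fromGrid _ _ (sameRow refl c≢β₂)) hb
                     (LT.fromGrid′ b≡Tβ refl (sameCol (λ e → ρ≢β₁ (sym e)) refl))
          where
            hit-at : ∃ λ c → atDist G j x (LT.f (ρ , c)) ≡ true
            hit-at = anyB-witness (λ c → atDist G j x (LT.f (ρ , c))) hit
            hd : atDist G j x (LT.f (ρ , proj₁ hit-at)) ≡ true
            hd = proj₂ hit-at
            ρ≢β₁ : ρ ≢ proj₁ β
            ρ≢β₁ e = clearLine j T hb′ (sameRow-near e) hd
            c≢β₂ : proj₁ hit-at ≢ proj₂ β
            c≢β₂ e = clearLine j T hb′ (sameCol-near e) hd

        R : Fin n → Fin n → Bool
        R ρ c = eqB (LB.f (proj₁ τ₀ , c)) (LT.f (ρ , proj₂ β))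

        matching : rowsMeeting T j ≤ sumFin n (λ c → [ others c ])
        matching = countByMatching (finSum n) (finSum n) (sumFin-swap′ n (finSum n)) rowHit others R
            related preserves unique
          where
            related : ∀ ρ → rowHit ρ ≡ true → ∃ λ c → R ρ c ≡ true
            related ρ hit = let (c , _ , e) = columnIntoRow ρ (proj₁ (columnPoint ρ hit))
                            in c , eqB-intro e
            preserves : ∀ ρ c → rowHit ρ ≡ true → R ρ c ≡ true → others c ≡ true
            preserves ρ c hit r = ∧-intro (not-intro c≢τ₀₂)
                (subst (λ w → atDist G (suc j) x w ≡ true) (sym (eqB⇒≡ r)) (proj₂ (columnPoint ρ hit)))
              where
                -- the label τ₀ is t itself, which is not a neighbour of t
                c≢τ₀₂ : eqB c (proj₂ τ₀) ≡ true → ⊥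
                c≢τ₀₂ h with eqB⇒≡ h
                ... | refl with trans (sym (irrefl G (LB.f τ₀)))
                                  (subst (λ w → adj G (LB.f τ₀) w ≡ true) (sym (eqB⇒≡ r)) (LT.centre-adj (ρ , proj₂ β)))
                ...   | ()
            unique : ∀ ρ ρ′ c → rowHit ρ ≡ true → R ρ c ≡ true → rowHit ρ′ ≡ true → R ρ′ c ≡ true → ρ ≡ ρ′
            unique ρ ρ′ c _ r _ r′ = cong proj₁ (LT.f-injective _ _ (trans (sym (eqB⇒≡ r)) (eqB⇒≡ r′)))

    predecessorsInGrid : ∀ j → RowProperty j → ∀ {b} → atDist G (suc (suc j)) x b ≡ true
      → (B : LocallyGridAt n G b)
      → (suc m * suc m ≤ gridCount (λ p → atDist G (suc j) x (Labelling.f G B p)))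
      × (suc m ≤ rowsMeeting B (suc j))
    predecessorsInGrid j rowProp {b} hb B =
        denseGridSet (suc m) (λ p → atDist G (suc j) x (f p)) p₀ h₀
          (rowThroughPredecessor j rowProp hb B)
          (λ p → rowThroughPredecessor j rowProp hb (transposed G B) (transpose p))
      where
        open Labelling G B
        pred : ∃ λ t → atDist G (suc j) x t ≡ true × adj G t b ≡ true
        pred = predecessor (suc j) hb
        label₀ : ∃ λ p → f p ≡ proj₁ pred
        label₀ = f-onto (proj₁ pred) (adj-sym (proj₂ (proj₂ pred)))
        p₀ : Pt n
        p₀ = proj₁ label₀
        h₀ : atDist G (suc j) x (f p₀) ≡ true
        h₀ = subst (λ w → atDist G (suc j) x w ≡ true) (sym (proj₂ label₀)) (proj₁ (proj₂ pred))

    -- the row property at distance 2 propagates outward, since m + 1 ≥ m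
    rowProperty : RowProperty 1 → ∀ j → RowProperty (suc j)
    rowProperty base zero    = base
    rowProperty base (suc j) ht L =
      ≤-trans (n≤1+n m) (proj₂ (predecessorsInGrid (suc j) (rowProperty base j) ht L))

    backwardDegree : ∀ j → RowProperty j → ∀ {b} → atDist G (suc (suc j)) x b ≡ true
      → suc m * suc m ≤ layerNeighbours G x (suc j) b
    backwardDegree j rowProp {b} hb =
      ≤-trans (proj₁ (predecessorsInGrid j rowProp hb (LG b)))
              (≤-reflexive (sym (labelledCount G (LG b) (atDist G (suc j) x))))

module LayerBounds {N : ℕ} (n m : ℕ) (G : Graph N) (LG : LocallyGrid n G) (m≥2 : 2 ≤ m) (m<n : m ≤ n ∸ 1)
    (c₂≥2m : ∀ x y → atDist G 2 x y ≡ true → 2 * m ≤ c₂ G x y) (x : Fin N) where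
  open Distance G
  open AroundVertex G LG x
  open Induction m (≤-trans m≥2 (≤-trans m<n (m∸n≤m n 1)))

  base : RowProperty 1
  base ha = rowsMeeting-dist2 m ha (c₂≥2m x _ ha)

  -- from Γ_1(x) to Γ_2(x): x fills one row and one column of the grid at a
  layer₁ : 2 * m * k G 2 x ≤ (n ∸ 1) * (n ∸ 1) * k G 1 x
  layer₁ = layerCount G x 1 ((n ∸ 1) * (n ∸ 1)) (2 * m)
    (λ a ha → forwardBound 0 (LG a) 1 (rowsMeeting-dist1 (dist1⇒adj ha) (LG a))
                                      (rowsMeeting-dist1 (dist1⇒adj ha) (transposed G (LG a))))
    (λ b hb → ≤-trans (c₂≥2m x b hb)
                (countB-mono {g = λ z → adj G b z ∧ atDist G 1 x z}
                  (λ z h → ∧-intro (∧-snd {adj G x z} h) (adj⇒dist1 (∧-fst h)))))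

  -- from Γ_2(x) to Γ_3(x): Γ_1(x) meets m rows and m columns of the grid at a
  layer₂ : suc m * suc m * k G 3 x ≤ (n ∸ m) * (n ∸ m) * k G 2 x
  layer₂ = layerCount G x 2 ((n ∸ m) * (n ∸ m)) (suc m * suc m)
    (λ a ha → forwardBound 1 (LG a) m (base ha (LG a)) (base ha (transposed G (LG a))))
    (λ b hb → backwardDegree 1 base hb)

  -- deeper layers: Γ_{j+2}(x) meets m + 1 rows and columns of the grid at a ∈ Γ_{j+3}(x)
  layerDeep : ∀ j → suc m * suc m * k G (suc (suc (suc (suc j)))) x ≤ (n ∸ suc m) * (n ∸ suc m) * k G (suc (suc (suc j))) x
  layerDeep j = layerCount G x (suc (suc (suc j))) ((n ∸ suc m) * (n ∸ suc m)) (suc m * suc m)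
    (λ a ha → forwardBound (suc (suc j)) (LG a) (suc m) (dense ha (LG a)) (dense ha (transposed G (LG a))))
    (λ b hb → backwardDegree (suc (suc j)) (rowProperty base (suc j)) hb)
    where
      dense : ∀ {a} → atDist G (suc (suc (suc j))) x a ≡ true → (L : LocallyGridAt n G a)
            → suc m ≤ rowsMeeting L (suc (suc j))
      dense ha L = proj₂ (predecessorsInGrid (suc j) (rowProperty base j) ha L)

lemma4p6 : ∀ {N : ℕ} (n m : ℕ) (G : Graph N) → LocallyGrid n G
    → 2 ≤ m → m ≤ n ∸ 1
    → (∀ x y → atDist G 2 x y ≡ true → 2 * m ≤ c₂ G x y)
    → ∀ (x : Fin N) →
        (2 * m * k G 2 x ≤ n * n * ((n ∸ 1) * (n ∸ 1)))
      × ((m + 1) * (m + 1) * k G 3 x ≤ k G 2 x * ((n ∸ m) * (n ∸ m)))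
      × (2 * m * (k G 2 x * ((n ∸ m) * (n ∸ m)))
           ≤ n * n * ((n ∸ 1) * (n ∸ 1)) * ((n ∸ m) * (n ∸ m)))
      × (∀ e → IsEccentricity G x e → ∀ i → 4 ≤ i → i ≤ e
           → (m + 1) * (m + 1) * k G i x
               ≤ k G (i ∸ 1) x * ((n ∸ m ∸ 1) * (n ∸ m ∸ 1)))
lemma4p6 n m G LG m≥2 m<n c₂≥2m x = bound₂ , bound₃ , bound₂₃ , boundDeep
  where
    open LayerBounds n m G LG m≥2 m<n c₂≥2m x
    open AroundVertex G LG x using (k₁≤n²)
    square : ∀ {a b} → a ≡ b → a * a ≡ b * b
    square e = cong (λ s → s * s) e
    bound₂ : 2 * m * k G 2 x ≤ n * n * ((n ∸ 1) * (n ∸ 1))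
    bound₂ = subst (2 * m * k G 2 x ≤_) (*-comm ((n ∸ 1) * (n ∸ 1)) (n * n))
               (≤-trans layer₁ (*-monoʳ-≤ ((n ∸ 1) * (n ∸ 1)) k₁≤n²))
    bound₃ : (m + 1) * (m + 1) * k G 3 x ≤ k G 2 x * ((n ∸ m) * (n ∸ m))
    bound₃ = subst₂ _≤_ (cong (_* k G 3 x) (square (+-comm 1 m))) (*-comm ((n ∸ m) * (n ∸ m)) (k G 2 x)) layer₂
    bound₂₃ : 2 * m * (k G 2 x * ((n ∸ m) * (n ∸ m))) ≤ n * n * ((n ∸ 1) * (n ∸ 1)) * ((n ∸ m) * (n ∸ m))
    bound₂₃ = subst (_≤ n * n * ((n ∸ 1) * (n ∸ 1)) * ((n ∸ m) * (n ∸ m))) (*-assoc (2 * m) (k G 2 x) _)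
                (*-monoˡ-≤ ((n ∸ m) * (n ∸ m)) bound₂)
    -- beyond distance 3 the bound holds for every i ≥ 4, eccentricity or not
    boundDeep : ∀ e → IsEccentricity G x e → ∀ i → 4 ≤ i → i ≤ e
      → (m + 1) * (m + 1) * k G i x ≤ k G (i ∸ 1) x * ((n ∸ m ∸ 1) * (n ∸ m ∸ 1))
    boundDeep _ _ (suc (suc (suc (suc j)))) (s≤s (s≤s (s≤s (s≤s _)))) _ =
      subst₂ _≤_ (cong (_* k G (4 + j) x) (square (+-comm 1 m)))
        (trans (*-comm ((n ∸ suc m) * (n ∸ suc m)) (k G (3 + j) x))
               (cong (k G (3 + j) x *_) (square (sym (trans (∸-+-assoc n m 1) (cong (n ∸_) (+-comm m 1)))))))
        (layerDeep j)
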